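{- The normal remoteness $R^+$ of paths satisfies: 1. $R^+(P_1)=R^+(P_2)=R^+(P_3)=1$; 2. $R^+(P_4)=R^+(P_5)=2$; 3. $R^+(P_6)=R^+(P_7)=R^+(P_8)=3$; 4. $R^+(P_9)=R^+(P_{10})=4$; 5. $R^+(P_n)=3$ for every $n\ge 11$.
   Context: For $n\ge 0$, $P_n$ denotes the path on $n$ vertices ($P_0$ is the empty graph). A Node-Kayles move on a path $P_k$ with $k\ge 1$ chooses a vertex and deletes it together with its neighbours. The possible results are: $P_0$ if $k\in\{1,2\}$; $P_0$ or $P_1$ if $k=3$; and, for $k\ge 4$, $P_{k-2}$, $P_{k-3}$, or two paths $P_i,P_j$ with $j\ge i\ge1$, $i+j=k-3$. In the conjunctive compound game, a position $G$ is a finite multiset of paths (components). A move replaces every component simultaneously by the result of a Node-Kayles move on it; a component that splits into two paths yields two components. The set $O(G)$ of options of $G$ consists of all positions obtainable by one such move. In particular $O(G)=\emptyset$ as soon as some component is $P_0$. The normal remoteness $R^+$ is defined recursively as follows: - $R^+(G)=0$ if $O(G)=\emptyset$; - $R^+(G)=1+\min\{R^+(G'):G'\in O(G),\ R^+(G')\text{ even}\}$ if some option has even remoteness; - $R^+(G)=1+\max\{R^+(G'):G'\in O(G)\}$ otherwise, in which case all these values are odd. $R^+(P_n)$ denotes the remoteness of the position consisting of the single component $P_n$. -}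

module Defs where

open import Data.Nat using (ℕ; zero; suc; _+_; _∸_; _≤_; _≤?_)
open import Data.Nat.Properties using ()
open import Data.Bool using (Bool; true; false; if_then_else_)
open import Data.List using (List; []; _∷_; [_]; map; concatMap; _++_; filter; upTo)
open import Data.Nat.ListAction using (sum)
open import Data.Maybe using (Maybe; just; nothing)

-- A position of the conjunctive compound is a finite multiset of paths,
-- represented as a list of path sizes (P_k is represented by k).
Position : Set
Position = List ℕ

-- Node-Kayles moves on a single path P_k: the list of resulting
-- multisets of components (each a list of path sizes).
-- For k ≥ 4 (k = m + 4): P_{k-2}, P_{k-3}, and P_i , P_j with
-- 1 ≤ i ≤ j, i + j = k - 3 = m + 1  (i = suc t, j = m ∸ t, t < m+1).
splits : ℕ → List Position
splits m = map (λ t → suc t ∷ (m ∸ t) ∷ [])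
               (filter (λ t → suc t ≤? (m ∸ t)) (upTo (suc m)))

moves : ℕ → List Position
moves zero = []
moves (suc zero) = [ [ 0 ] ]
moves (suc (suc zero)) = [ [ 0 ] ]
moves (suc (suc (suc zero))) = [ 0 ] ∷ [ 1 ] ∷ []
moves (suc (suc (suc (suc m)))) = [ suc (suc m) ] ∷ [ suc m ] ∷ splits m

-- Options of a position: every component is replaced simultaneously by
-- the result of a Node-Kayles move on it.  If some component is P_0,
-- it has no moves and hence the position has no options.
options : Position → List Position
options [] = [ [] ]
options (k ∷ ks) = concatMap (λ r → map (r ++_) (options ks)) (moves k)

isEven : ℕ → Bool
isEven zero = true
isEven (suc zero) = false
isEven (suc (suc n)) = isEven n

minEven : List ℕ → Maybe ℕ
minEven [] = nothing
minEven (x ∷ xs) with isEven x | minEven xs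
... | false | r = r
... | true | nothing = just x
... | true | just y = just (if x Data.Nat.≤ᵇ y then x else y)

maxList : List ℕ → ℕ
maxList [] = 0
maxList (x ∷ xs) = x Data.Nat.⊔ maxList xs

remStep : List ℕ → ℕ
remStep [] = 0
remStep (v ∷ vs) with minEven (v ∷ vs)
... | just e = suc e
... | nothing = suc (maxList (v ∷ vs))

remFuel : ℕ → Position → ℕ
remFuel zero G = 0
remFuel (suc f) G = remStep (map (remFuel f) (options G))

-- On a nonempty position every move removes at least
-- one vertex from each component, so the total number of vertices strictly
-- decreases; fuel  1 + (number of vertices)  therefore suffices and R⁺
-- agrees with the recursive definition.
R⁺ : Position → ℕ
R⁺ G = remFuel (suc (sum G)) G

R⁺P : ℕ → ℕ
R⁺P n = R⁺ [ n ]

-- A path P_n with n ≥ 11 can be split into P_4 and P_{n-7}, where n - 7 ≥ 4.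
-- In that position every move turns P_4 into P_2 or P_1, after which the
-- opponent kills that component and ends the game; so {P_4, P_{n-7}} has
-- remoteness 2.  Every option of P_n (n ≥ 4) has positive remoteness, hence 2
-- is the least even remoteness of an option and R⁺(P_n) = 3.  The small cases
-- are finite computations.
module Submission where

open import Defs
open import Data.Nat using (ℕ; _≤_)
open import Data.Product using (_×_)
open import Relation.Binary.PropositionalEquality using (_≡_)

open import Data.Bool using (true; false; if_then_else_)
open import Data.List using ([]; _∷_; [_]; map; _++_; upTo)
open import Data.List.Membership.Propositional using (_∈_; find)
open import Data.List.Membership.Propositional.Properties
  using (∈-map⁺; ∈-map⁻; ∈-concat⁺′; ∈-concatMap⁻; ∈-filter⁺; ∈-upTo⁺)
open import Data.List.Relation.Unary.All as All using (All; []; _∷_; tabulate)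
import Data.List.Relation.Unary.All.Properties as All
open import Data.List.Relation.Unary.Any using (here; there)
open import Data.Maybe using (just; nothing)
import Data.Maybe.Relation.Unary.All as Maybe
open import Data.Nat using (zero; suc; _+_; _∸_; _⊓_; _≤ᵇ_; _≤?_; z≤n; s≤s)
open import Data.Nat.Properties
  using ( ≤ᵇ-reflects-≤; ≰⇒≥; ⊓-glb; m≤n⇒m⊓n≡m; m≥n⇒m⊓n≡n; ≤-trans; ⊔-identityʳ; ⊔-idem
        ; m≤m+n; m+n∸m≡n; m≤n⇒∃[o]m+o≡n)
open import Data.Product using (_,_; ∃; ∃₂)
open import Function using (_∘_)
open import Relation.Nullary.Reflects using (ofʸ; ofⁿ)
open import Relation.Binary.PropositionalEquality using (refl; sym; trans; cong; subst)

Positive : Position → Set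
Positive = All (1 ≤_)

if-≤ᵇ≡⊓ : ∀ x y → (if x ≤ᵇ y then x else y) ≡ x ⊓ y
if-≤ᵇ≡⊓ x y with x ≤ᵇ y | ≤ᵇ-reflects-≤ x y
... | true  | ofʸ x≤y = sym (m≤n⇒m⊓n≡m x≤y)
... | false | ofⁿ x≰y = sym (m≥n⇒m⊓n≡n (≰⇒≥ x≰y))

EvenAbove : ℕ → ℕ → Set
EvenAbove e v = isEven v ≡ true → e ≤ v

minEven-lowerBound : ∀ {e xs} → All (EvenAbove e) xs → Maybe.All (e ≤_) (minEven xs)
minEven-lowerBound {xs = []} [] = Maybe.nothing
minEven-lowerBound {xs = x ∷ xs} (e≤x ∷ bounds)
  with isEven x | minEven xs | minEven-lowerBound bounds
... | false | _      | bound          = bound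
... | true  | _      | Maybe.nothing  = Maybe.just (e≤x refl)
... | true  | just y | Maybe.just e≤y =
  Maybe.just (subst (_ ≤_) (sym (if-≤ᵇ≡⊓ x y)) (⊓-glb (e≤x refl) e≤y))

minEven-least : ∀ {e xs} → isEven e ≡ true → e ∈ xs → All (EvenAbove e) xs →
                minEven xs ≡ just e
minEven-least {e} {e ∷ xs} even (here refl) (_ ∷ bounds) rewrite even
  with minEven xs | minEven-lowerBound bounds
... | nothing | Maybe.nothing  = refl
... | just y  | Maybe.just e≤y = cong just (trans (if-≤ᵇ≡⊓ e y) (m≤n⇒m⊓n≡m e≤y))
minEven-least {e} {x ∷ xs} even (there e∈xs) (e≤x ∷ bounds)
  with isEven x | minEven xs | minEven-least even e∈xs bounds
... | false | _ | minEven≡e = minEven≡e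
... | true  | _ | refl      = cong just (trans (if-≤ᵇ≡⊓ x e) (m≥n⇒m⊓n≡n (e≤x refl)))

minEven-allOdd : ∀ {xs} → All (λ x → isEven x ≡ false) xs → minEven xs ≡ nothing
minEven-allOdd [] = refl
minEven-allOdd (odd ∷ odds) rewrite odd = minEven-allOdd odds

maxList-constant : ∀ {o v vs} → All (_≡ o) (v ∷ vs) → maxList (v ∷ vs) ≡ o
maxList-constant {o} (refl ∷ []) = ⊔-identityʳ o
maxList-constant {o} (refl ∷ rest@(_ ∷ _)) rewrite maxList-constant rest = ⊔-idem o

remStep-positive : ∀ {v vs} → v ∈ vs → 1 ≤ remStep vs
remStep-positive {vs = w ∷ ws} _ with minEven (w ∷ ws)
... | just _  = s≤s z≤n
... | nothing = s≤s z≤n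

remStep-leastEven : ∀ {e vs} → isEven e ≡ true → e ∈ vs → All (EvenAbove e) vs →
                    remStep vs ≡ suc e
remStep-leastEven {vs = w ∷ ws} even e∈vs bounds
  rewrite minEven-least even e∈vs bounds = refl

remStep-constantOdd : ∀ {o v vs} → isEven o ≡ false → v ∈ vs → All (_≡ o) vs →
                      remStep vs ≡ suc o
remStep-constantOdd {vs = w ∷ ws} odd _ constant
  rewrite minEven-allOdd (All.map (λ { refl → odd }) constant)
  = cong suc (maxList-constant constant)

positive-even⇒≥2 : ∀ {v} → 1 ≤ v → EvenAbove 2 v
positive-even⇒≥2 {suc zero}    _ ()
positive-even⇒≥2 {suc (suc _)} _ _ = s≤s (s≤s z≤n)

∈-options⁺ : ∀ {k ks r H} → r ∈ moves k → H ∈ options ks → r ++ H ∈ options (k ∷ ks)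
∈-options⁺ {ks = ks} r∈ H∈ =
  ∈-concat⁺′ (∈-map⁺ _ H∈) (∈-map⁺ (λ r → map (r ++_) (options ks)) r∈)

∈-options⁻ : ∀ {k ks G} → G ∈ options (k ∷ ks) →
             ∃₂ λ r H → r ∈ moves k × H ∈ options ks × G ≡ r ++ H
∈-options⁻ {k} G∈ with find (∈-concatMap⁻ _ {xs = moves k} G∈)
... | r , r∈ , G∈rH with ∈-map⁻ (r ++_) G∈rH
...   | H , H∈ , refl = r , H , r∈ , H∈ , refl

moves-nonempty : ∀ k → ∃ (_∈ moves (suc k))
moves-nonempty zero                = _ , here refl
moves-nonempty (suc zero)          = _ , here refl
moves-nonempty (suc (suc zero))    = _ , here refl
moves-nonempty (suc (suc (suc _))) = _ , here refl

options-nonempty : ∀ {G} → Positive G → ∃ (_∈ options G)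
options-nonempty [] = [] , here refl
options-nonempty {suc k ∷ ks} (_ ∷ positive)
  with moves-nonempty k | options-nonempty positive
... | _ , r∈ | _ , H∈ = _ , ∈-options⁺ {ks = ks} r∈ H∈

splits-positive : ∀ m → All Positive (splits m)
splits-positive m =
  All.map⁺ (All.map (λ i≤j → s≤s z≤n ∷ ≤-trans (s≤s z≤n) i≤j ∷ [])
                    (All.all-filter (λ t → suc t ≤? m ∸ t) (upTo (suc m))))

moves-positive : ∀ {k} → 4 ≤ k → All Positive (moves k)
moves-positive {suc (suc (suc (suc m)))} (s≤s (s≤s (s≤s (s≤s _)))) =
  (s≤s z≤n ∷ []) ∷ (s≤s z≤n ∷ []) ∷ splits-positive m

options-positive : ∀ {G} → All (4 ≤_) G → All Positive (options G)
options-positive [] = tabulate λ { (here refl) → [] }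
options-positive {k ∷ ks} (4≤k ∷ large) = tabulate option-positive
  where
  option-positive : ∀ {G} → G ∈ options (k ∷ ks) → Positive G
  option-positive G∈ with ∈-options⁻ {k} {ks} G∈
  ... | _ , _ , r∈ , H∈ , refl =
    All.++⁺ (All.lookup (moves-positive 4≤k) r∈) (All.lookup (options-positive {ks} large) H∈)

∈-moves-split : ∀ {i j} → 1 ≤ i → i ≤ j → i ∷ j ∷ [] ∈ moves (3 + i + j)
∈-moves-split {suc t} {j} _ i≤j =
  there (there (subst (λ j′ → suc t ∷ j′ ∷ [] ∈ splits (t + j)) (m+n∸m≡n t j)
    (∈-map⁺ _ (∈-filter⁺ (λ t′ → suc t′ ≤? t + j ∸ t′)
                         (∈-upTo⁺ (s≤s (m≤m+n t j)))
                         (subst (suc t ≤_) (sym (m+n∸m≡n t j)) i≤j)))))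

remFuel-terminal : ∀ f {G} → options G ≡ [] → remFuel f G ≡ 0
remFuel-terminal zero    _ = refl
remFuel-terminal (suc f) terminal rewrite terminal = refl

remFuel-positive : ∀ f {G} → Positive G → 1 ≤ remFuel (suc f) G
remFuel-positive f positive with options-nonempty positive
... | _ , G′∈ = remStep-positive (∈-map⁺ (remFuel f) G′∈)

remFuel-vanishingMove : ∀ f {a G} → [ 0 ] ∈ moves a → Positive G →
                        remFuel (2 + f) (a ∷ G) ≡ 1
remFuel-vanishingMove f {a} {G} vanish positive with options-nonempty positive
... | H , H∈ = remStep-leastEven refl
  (subst (_∈ map (remFuel (suc f)) (options (a ∷ G)))
         (remFuel-terminal (suc f) {0 ∷ H} refl)
         (∈-map⁺ (remFuel (suc f)) (∈-options⁺ {a} {G} vanish H∈)))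
  (All.universal (λ _ _ → z≤n) _)

remFuel-beside-P₄ : ∀ f {G} → All (4 ≤_) G → remFuel (3 + f) (4 ∷ G) ≡ 2
remFuel-beside-P₄ f {G} large
  with options-nonempty {4 ∷ G} (s≤s z≤n ∷ All.map (≤-trans (s≤s z≤n)) large)
... | _ , G′∈ =
  remStep-constantOdd refl (∈-map⁺ _ G′∈) (All.map⁺ (tabulate option-remoteness))
  where
  option-remoteness : ∀ {G′} → G′ ∈ options (4 ∷ G) → remFuel (2 + f) G′ ≡ 1
  option-remoteness G′∈ with ∈-options⁻ {4} {G} G′∈
  ... | _ , H , here refl         , H∈ , refl =
    remFuel-vanishingMove f {2} (here refl) (All.lookup (options-positive large) H∈)
  ... | _ , H , there (here refl) , H∈ , refl =
    remFuel-vanishingMove f {1} (here refl) (All.lookup (options-positive large) H∈)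

remFuel-longPath : ∀ f k → remFuel (4 + f) [ 11 + k ] ≡ 3
remFuel-longPath f k =
  remStep-leastEven refl two∈
    (All.map⁺ (All.map (positive-even⇒≥2 ∘ remFuel-positive (2 + f)) options-large))
  where
  options-large : All Positive (options [ 11 + k ])
  options-large = options-positive (m≤m+n 4 (7 + k) ∷ [])

  split∈ : 4 ∷ 4 + k ∷ [] ∈ options [ 11 + k ]
  split∈ = ∈-options⁺ {11 + k} {[]} (∈-moves-split (s≤s z≤n) (m≤m+n 4 k)) (here refl)

  two∈ : 2 ∈ map (remFuel (3 + f)) (options [ 11 + k ])
  two∈ = subst (_∈ map (remFuel (3 + f)) (options [ 11 + k ]))
               (remFuel-beside-P₄ f (m≤m+n 4 k ∷ [])) (∈-map⁺ (remFuel (3 + f)) split∈)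

theorem2 : (R⁺P 1 ≡ 1 × R⁺P 2 ≡ 1 × R⁺P 3 ≡ 1)
    × (R⁺P 4 ≡ 2 × R⁺P 5 ≡ 2)
    × (R⁺P 6 ≡ 3 × R⁺P 7 ≡ 3 × R⁺P 8 ≡ 3)
    × (R⁺P 9 ≡ 4 × R⁺P 10 ≡ 4)
    × (∀ (n : ℕ) → 11 ≤ n → R⁺P n ≡ 3)
theorem2 = (refl , refl , refl) , (refl , refl) , (refl , refl , refl) , (refl , refl) , long
  where
  long : ∀ n → 11 ≤ n → R⁺P n ≡ 3
  long n 11≤n with m≤n⇒∃[o]m+o≡n 11≤n
  -- R⁺P (11 + k) unfolds to remFuel (suc ((11 + k) + 0)) [ 11 + k ].
  ... | k , refl = remFuel-longPath (8 + (k + 0)) k
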